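{- Let $k\ge2$, $N\ge1$ and $n=\lfloor\log_k(N(k-1)+1)\rfloor$. The number of times the root fires is \[f_0(N,k)=\frac{1}{k-1}\sum_{j=1}^{n-1}(k^j-1)\,c_j(N,k).\]
   Context: Fix an integer $k\ge 2$. Let $T_k$ be the infinite rooted $k$-ary tree (every vertex has exactly $k$ children) with one additional self-loop at the root, so every vertex has degree $k+1$. A vertex is on layer $i+1$ if its distance from the root is $i$ (the root is on layer 1). Chip-firing: a vertex with at least $k+1$ chips may fire, sending one chip along each incident edge (a non-root vertex sends one chip to its parent and one to each of its $k$ children; the root sends one chip to each of its $k$ children and one chip to itself along the self-loop). Starting with $N$ chips at the root and none elsewhere, vertices fire until no vertex can fire; this terminates, and the stable configuration and the number of times each vertex fires do not depend on the order of firings. All vertices on the same layer carry the same number of chips in the stable configuration; $c_j(N,k)$ denotes the number of chips on each vertex of layer $j+1$ in the stable configuration, and $f_0(N,k)$ the number of times the root fires. -}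

module Defs where

open import Data.Nat using (ℕ; zero; suc; _+_; _*_; _∸_; _^_; _≤_; _<_; z≤n; s≤s)
open import Data.Nat.Properties using (≤-trans)
open import Data.Fin using (Fin; fromℕ<)
import Data.Fin.Properties as FinP
open import Data.List using (List; []; _∷_; replicate)
import Data.List.Properties as ListP
open import Relation.Nullary using (Dec; yes; no)
open import Relation.Binary.PropositionalEquality using (_≡_)

-- A vertex of the infinite rooted k-ary tree T_k is the path from the root,
-- stored newest-step-first: [] is the root, the children of v are (i ∷ v)
-- for i : Fin k, and the parent of (i ∷ v) is v.  The depth (= length) of
-- a vertex is its distance from the root, so it lies on layer (depth + 1).
Vertex : ℕ → Set
Vertex k = List (Fin k)

_≟V_ : ∀ {k} → (v w : Vertex k) → Dec (v ≡ w)
_≟V_ = ListP.≡-dec FinP._≟_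

Config : ℕ → Set
Config k = Vertex k → ℕ

[_] : ∀ {P : Set} → Dec P → ℕ
[ yes _ ] = 1
[ no  _ ] = 0

childOf : ∀ {k} → Vertex k → Vertex k → ℕ
childOf v []      = 0
childOf v (_ ∷ u) = [ u ≟V v ]

parentOf : ∀ {k} → Vertex k → Vertex k → ℕ
parentOf []      w = 0
parentOf (_ ∷ u) w = [ w ≟V u ]

selfLoop : ∀ {k} → Vertex k → Vertex k → ℕ
selfLoop []      []      = 1
selfLoop []      (_ ∷ _) = 0
selfLoop (_ ∷ _) w       = 0

inflow : ∀ {k} → Vertex k → Vertex k → ℕ
inflow v w = childOf v w + parentOf v w + selfLoop v w

-- fire vertex v (v sends one chip along each of its k+1 incident edge-ends)
fire : (k : ℕ) → Config k → Vertex k → Config k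
fire k c v w = (c w ∸ (suc k) * [ w ≟V v ]) + inflow v w

Stable : (k : ℕ) → Config k → Set
Stable k c = ∀ v → c v < suc k

data Run (k : ℕ) : Config k → Config k → ℕ → Set where
  done : ∀ {c} → Stable k c → Run k c c 0
  step : ∀ {c c' m} (v : Vertex k) → suc k ≤ c v →
         Run k (fire k c v) c' m → Run k c c' ([ v ≟V [] ] + m)

initial : (k N : ℕ) → Config k
initial k N []      = N
initial k N (_ ∷ _) = 0

-- the leftmost vertex at distance j from the root (on layer j+1)
leftmost : (k : ℕ) → 2 ≤ k → ℕ → Vertex k
leftmost k h j = replicate j (fromℕ< {0} {k} (≤-trans (s≤s z≤n) h))

sumFrom1 : ℕ → (ℕ → ℕ) → ℕ
sumFrom1 zero    f = 0
sumFrom1 (suc n) f = sumFrom1 n f + f (suc n)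

{-# OPTIONS --safe #-}
module Submission where

-- Let y be the firing vector of the run.  Conservation of chips reads
-- c′ + (k+1)·y = c + (chips received under y) at every vertex, and by the least
-- action principle y is bounded by every firing vector that would leave at most
-- k chips everywhere.  Two such bounds give the structure of y: its layerwise
-- minimum (so y is constant on layers) and an explicit profile of the height
-- (n − 1) ∸ depth (so y vanishes from depth n − 1 on).  With F and c the layer
-- values, conservation at depth e + 1 reads c(e+1) + (k+1)·F(e+1) = F(e) + k·F(e+2);
-- weighted by geom k (e+1) = 1 + k + ⋯ + kᵉ these telescope to
-- f₀ = F(0) = Σⱼ geom k j · c(j), and (k − 1)·geom k j = kʲ − 1.

open import Defs
open import Data.Nat using (ℕ; zero; suc; _+_; _*_; _∸_; _^_; _≤_; _<_; _⊓_; z≤n; s≤s)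
open import Data.Nat.Properties
open import Data.Nat.Tactic.RingSolver using (solve-∀)
open import Data.Fin using (Fin; zero; suc)
import Data.Fin.Properties as FinP
open import Data.List using ([]; _∷_; length)
open import Data.List.Properties using (∷-injectiveˡ; ∷-injectiveʳ; length-replicate)
open import Data.Product using (∃; _×_; _,_)
open import Data.Sum using (inj₁; inj₂)
open import Function using (_∘_)
open import Relation.Nullary using (Dec; yes; no; ¬_; contradiction)
open import Relation.Binary.PropositionalEquality hiding ([_])
open import Algebra.Properties.Semiring.Sum +-*-semiring using (sum; sum-cong-≗; ∑-distrib-+; sum-replicate-zero)
open import Algebra.Properties.CommutativeSemigroup +-commutativeSemigroup using (interchange; xy∙z≈xz∙y; x∙yz≈xz∙y)

indicator-yes : ∀ {P : Set} (d : Dec P) → P → [ d ] ≡ 1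
indicator-yes (yes _) _  = refl
indicator-yes (no ¬p) p = contradiction p ¬p

indicator-no : ∀ {P : Set} (d : Dec P) → ¬ P → [ d ] ≡ 0
indicator-no (yes p) ¬p = contradiction p ¬p
indicator-no (no _)  _  = refl

sum-const : ∀ n x → sum {n} (λ _ → x) ≡ n * x
sum-const zero    x = refl
sum-const (suc n) x = cong (x +_) (sum-const n x)

sum-mono-≤ : ∀ {n} {f g : Fin n → ℕ} → (∀ i → f i ≤ g i) → sum f ≤ sum g
sum-mono-≤ {zero}  _   = z≤n
sum-mono-≤ {suc n} f≤g = +-mono-≤ (f≤g zero) (sum-mono-≤ (f≤g ∘ suc))

sum-indicator-none : ∀ {n} {P : Fin n → Set} (d : ∀ i → Dec (P i)) →
                     (∀ i → ¬ P i) → sum (λ i → [ d i ]) ≡ 0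
sum-indicator-none {zero}  d ¬P = refl
sum-indicator-none {suc n} d ¬P =
  cong₂ _+_ (indicator-no (d zero) (¬P zero)) (sum-indicator-none (d ∘ suc) (¬P ∘ suc))

sum-indicator-unique : ∀ {n} {P : Fin n → Set} (d : ∀ i → Dec (P i)) j →
                       P j → (∀ i → P i → i ≡ j) → sum (λ i → [ d i ]) ≡ 1
sum-indicator-unique d zero Pj unique =
  cong₂ _+_ (indicator-yes (d zero) Pj)
            (sum-indicator-none (d ∘ suc) (λ i Pi → FinP.0≢1+n (sym (unique (suc i) Pi))))
sum-indicator-unique d (suc j) Pj unique =
  cong₂ _+_ (indicator-no (d zero) (λ P0 → FinP.0≢1+n (unique zero P0)))
            (sum-indicator-unique (d ∘ suc) j Pj (λ i Pi → FinP.suc-injective (unique (suc i) Pi)))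

minimum : ∀ {n} → (Fin n → ℕ) → ℕ
minimum {zero}        g = 0
minimum {suc zero}    g = g zero
minimum {suc (suc n)} g = g zero ⊓ minimum (g ∘ suc)

minimum-≤ : ∀ {n} (g : Fin n → ℕ) i → minimum g ≤ g i
minimum-≤ {suc zero}    g zero    = ≤-refl
minimum-≤ {suc (suc n)} g zero    = m⊓n≤m _ _
minimum-≤ {suc (suc n)} g (suc i) = ≤-trans (m⊓n≤n _ _) (minimum-≤ (g ∘ suc) i)

minimum-attained : ∀ {n} (g : Fin n → ℕ) → Fin n → ∃ λ i → g i ≡ minimum g
minimum-attained {suc zero}    g _ = zero , refl
minimum-attained {suc (suc n)} g _
  with ⊓-sel (g zero) (minimum (g ∘ suc)) | minimum-attained (g ∘ suc) zero
... | inj₁ min≡g0   | _            = zero , sym min≡g0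
... | inj₂ min≡rest | i , gi≡min   = suc i , trans gi≡min (sym min≡rest)

geom : ℕ → ℕ → ℕ
geom k zero    = 0
geom k (suc j) = 1 + k * geom k j

geom-pow : ∀ a j → a * geom (suc a) j + 1 ≡ suc a ^ j
geom-pow a zero    = cong (_+ 1) (*-zeroʳ a)
geom-pow a (suc j) = trans (shift a (geom (suc a) j)) (cong (suc a *_) (geom-pow a j))
  where
  shift : ∀ a g → a * (1 + suc a * g) + 1 ≡ suc a * (a * g + 1)
  shift = solve-∀

k^j∸1≡[k∸1]*geom : ∀ k j → k ^ j ∸ 1 ≡ (k ∸ 1) * geom k j
k^j∸1≡[k∸1]*geom zero    zero    = refl
k^j∸1≡[k∸1]*geom zero    (suc j) = refl
k^j∸1≡[k∸1]*geom (suc a) j       = trans (cong (_∸ 1) (sym (geom-pow a j))) (m+n∸n≡m _ 1)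

geom-upper-bound : ∀ k N n → N * (k ∸ 1) + 1 < k ^ suc n → N ≤ k * geom k (suc (n ∸ 1))
geom-upper-bound zero    N n ()
geom-upper-bound (suc a) N n N*a+1<k^[1+n] = widen n (≤-pred N<geom)
  where
  open ≤-Reasoning
  N<geom : N < geom (suc a) (suc n)
  N<geom = *-cancelˡ-< a N _ (begin-strict
    a * N                    ≡⟨ *-comm a N ⟩
    N * a                    <⟨ +-cancelʳ-< 1 (N * a) _ (≤-trans N*a+1<k^[1+n] (≤-reflexive (sym (geom-pow a (suc n))))) ⟩
    a * geom (suc a) (suc n) ∎)
  widen : ∀ n → N ≤ suc a * geom (suc a) n → N ≤ suc a * geom (suc a) (suc (n ∸ 1))
  widen zero    N≤0 = ≤-trans N≤0 (*-monoʳ-≤ (suc a) z≤n)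
  widen (suc _) N≤  = N≤

-- Fired at height m ∸ depth, the profile leaves exactly k chips on every
-- non-root vertex above depth m (profile-recurrence).
profile : ℕ → ℕ → ℕ
profile k zero    = 0
profile k (suc t) = profile k t + k * geom k (suc t)

profile-recurrence : ∀ k t → suc (profile k (suc t) + k * profile k (t ∸ 1)) ≡ suc k * suc (profile k t)
profile-recurrence k zero    = base k
  where
  base : ∀ k → suc (k * (1 + k * 0) + k * 0) ≡ suc k * suc 0
  base = solve-∀
profile-recurrence k (suc t) = unfolded k (profile k t) (k * geom k (suc t))
  where
  unfolded : ∀ k P Q → suc ((P + Q) + k * (1 + Q) + k * P) ≡ suc k * suc (P + Q)
  unfolded = solve-∀

profile-interior : ∀ k m d →
  profile k (m ∸ d) + k * profile k (m ∸ suc (suc d)) < suc k * suc (profile k (m ∸ suc d))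
profile-interior k zero    zero    = s≤s (*-monoʳ-≤ k z≤n)
profile-interior k zero    (suc d) = s≤s (*-monoʳ-≤ k z≤n)
profile-interior k (suc m) zero    = ≤-reflexive (profile-recurrence k m)
profile-interior k (suc m) (suc d) = profile-interior k m d

profile-root : ∀ k N m → N ≤ k * geom k (suc m) →
  N + (profile k m + k * profile k (m ∸ 1)) < suc k * suc (profile k m)
profile-root k N m N≤ = begin-strict
  N + (profile k m + k * profile k (m ∸ 1))   ≡⟨ +-assoc N _ _ ⟨
  N + profile k m + k * profile k (m ∸ 1)     ≤⟨ +-monoˡ-≤ _ (≤-trans (≤-reflexive (+-comm N _)) (+-monoʳ-≤ (profile k m) N≤)) ⟩
  profile k (suc m) + k * profile k (m ∸ 1)   <⟨ ≤-reflexive (profile-recurrence k m) ⟩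
  suc k * suc (profile k m)                   ∎
  where open ≤-Reasoning

sumFrom1-cong : ∀ n {f g : ℕ → ℕ} → (∀ j → f j ≡ g j) → sumFrom1 n f ≡ sumFrom1 n g
sumFrom1-cong zero    f≡g = refl
sumFrom1-cong (suc n) f≡g = cong₂ _+_ (sumFrom1-cong n f≡g) (f≡g (suc n))

sumFrom1-*ˡ : ∀ a n (f : ℕ → ℕ) → sumFrom1 n (λ j → a * f j) ≡ a * sumFrom1 n f
sumFrom1-*ˡ a zero    f = sym (*-zeroʳ a)
sumFrom1-*ˡ a (suc n) f = trans (cong (_+ a * f (suc n)) (sumFrom1-*ˡ a n f)) (sym (*-distribˡ-+ a _ _))

LayerBalance : ℕ → (ℕ → ℕ) → (ℕ → ℕ) → Set
LayerBalance k F C = ∀ e → C (suc e) + suc k * F (suc e) ≡ F e + k * F (suc (suc e))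

weighted-chips-telescope : ∀ k (F C : ℕ → ℕ) → LayerBalance k F C → ∀ e →
  sumFrom1 e (λ j → geom k j * C j) + geom k (suc e) * F e ≡ F 0 + k * geom k e * F (suc e)
weighted-chips-telescope k F C balance zero    = base k (F 0) (F 1)
  where
  base : ∀ k F₀ F₁ → 0 + (1 + k * 0) * F₀ ≡ F₀ + k * 0 * F₁
  base = solve-∀
weighted-chips-telescope k F C balance (suc e) = +-cancelʳ-≡ (X * F e) _ _ (begin
  S + X * C (suc e) + (1 + k * X) * F (suc e) + X * F e
    ≡⟨ regroup S (X * C (suc e)) ((1 + k * X) * F (suc e)) (X * F e) ⟩
  (S + X * F e) + (X * C (suc e) + (1 + k * X) * F (suc e))
    ≡⟨ cong (_+ (X * C (suc e) + (1 + k * X) * F (suc e))) (weighted-chips-telescope k F C balance e) ⟩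
  (F 0 + k * G * F (suc e)) + (X * C (suc e) + (1 + k * X) * F (suc e))
    ≡⟨ collect k G (F 0) (C (suc e)) (F (suc e)) ⟩
  F 0 + X * (C (suc e) + suc k * F (suc e))
    ≡⟨ cong (λ t → F 0 + X * t) (balance e) ⟩
  F 0 + X * (F e + k * F (suc (suc e)))
    ≡⟨ distribute k X (F 0) (F e) (F (suc (suc e))) ⟩
  F 0 + k * X * F (suc (suc e)) + X * F e ∎)
  where
  open ≡-Reasoning
  S = sumFrom1 e (λ j → geom k j * C j)
  G = geom k e
  X = geom k (suc e)
  regroup : ∀ s a b c → s + a + b + c ≡ (s + c) + (a + b)
  regroup = solve-∀
  collect : ∀ k g f₀ c f → (f₀ + k * g * f) + ((1 + k * g) * c + (1 + k * (1 + k * g)) * f) ≡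
                           f₀ + (1 + k * g) * (c + suc k * f)
  collect = solve-∀
  distribute : ∀ k x f₀ f f″ → f₀ + x * (f + k * f″) ≡ f₀ + k * x * f″ + x * f
  distribute = solve-∀

weighted-chips≡root : ∀ k (F C : ℕ → ℕ) → LayerBalance k F C → ∀ m → F m ≡ 0 → F (suc m) ≡ 0 →
  sumFrom1 m (λ j → geom k j * C j) ≡ F 0
weighted-chips≡root k F C balance m Fm≡0 F[1+m]≡0 = begin
  S                                   ≡⟨ +-identityʳ S ⟨
  S + 0                               ≡⟨ cong (S +_) (*-zeroʳ (geom k (suc m))) ⟨
  S + geom k (suc m) * 0              ≡⟨ cong (λ t → S + geom k (suc m) * t) Fm≡0 ⟨
  S + geom k (suc m) * F m            ≡⟨ weighted-chips-telescope k F C balance m ⟩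
  F 0 + k * geom k m * F (suc m)      ≡⟨ cong (λ t → F 0 + k * geom k m * t) F[1+m]≡0 ⟩
  F 0 + k * geom k m * 0              ≡⟨ cong (F 0 +_) (*-zeroʳ (k * geom k m)) ⟩
  F 0 + 0                             ≡⟨ +-identityʳ (F 0) ⟩
  F 0                                 ∎
  where
  open ≡-Reasoning
  S = sumFrom1 m (λ j → geom k j * C j)

module ChipFiring (k : ℕ) where

  δ : Vertex k → Vertex k → ℕ
  δ v u = [ u ≟V v ]

  δ-root : ∀ v → [ v ≟V [] ] ≡ δ v []
  δ-root []      = refl
  δ-root (_ ∷ _) = refl

  -- The neighbour of w towards the root; through its self-loop the root is its own.
  up : (Vertex k → ℕ) → Vertex k → ℕ
  up y []      = y []
  up y (_ ∷ p) = y p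

  received : (Vertex k → ℕ) → Vertex k → ℕ
  received y w = up y w + sum (λ i → y (i ∷ w))

  received-+ : ∀ y z w → received (λ u → y u + z u) w ≡ received y w + received z w
  received-+ y z w = trans (cong₂ _+_ (up-+ w) (∑-distrib-+ (λ i → y (i ∷ w)) (λ i → z (i ∷ w))))
                           (interchange (up y w) (up z w) _ _)
    where
    up-+ : ∀ w → up (λ u → y u + z u) w ≡ up y w + up z w
    up-+ [] = refl
    up-+ (_ ∷ _) = refl

  received-mono : ∀ {y z} → (∀ u → y u ≤ z u) → ∀ w → received y w ≤ received z w
  received-mono y≤z []      = +-mono-≤ (y≤z []) (sum-mono-≤ (λ i → y≤z (i ∷ [])))
  received-mono y≤z (a ∷ p) = +-mono-≤ (y≤z p) (sum-mono-≤ (λ i → y≤z (i ∷ a ∷ p)))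

  received-zero : ∀ w → received (λ _ → 0) w ≡ 0
  received-zero []      = sum-replicate-zero k
  received-zero (_ ∷ _) = sum-replicate-zero k

  up-δ : ∀ v w → up (δ v) w ≡ childOf v w + selfLoop v w
  up-δ []      []      = refl
  up-δ (_ ∷ _) []      = refl
  up-δ []      (_ ∷ _) = sym (+-identityʳ _)
  up-δ (_ ∷ _) (_ ∷ _) = sym (+-identityʳ _)

  children-δ : ∀ v w → sum (λ i → δ v (i ∷ w)) ≡ parentOf v w
  children-δ []      w = sum-indicator-none (λ i → (i ∷ w) ≟V []) (λ i ())
  children-δ (j ∷ u) w = by-cases (w ≟V u)
    where
    by-cases : Dec (w ≡ u) → sum (λ i → δ (j ∷ u) (i ∷ w)) ≡ parentOf (j ∷ u) w
    by-cases (yes w≡u) = trans (sum-indicator-unique (λ i → (i ∷ w) ≟V (j ∷ u)) j (cong (j ∷_) w≡u) (λ i → ∷-injectiveˡ))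
                               (sym (indicator-yes (w ≟V u) w≡u))
    by-cases (no w≢u)  = trans (sum-indicator-none (λ i → (i ∷ w) ≟V (j ∷ u)) (λ i → w≢u ∘ ∷-injectiveʳ))
                               (sym (indicator-no (w ≟V u) w≢u))

  received-δ : ∀ v w → received (δ v) w ≡ inflow v w
  received-δ v w = trans (cong₂ _+_ (up-δ v w) (children-δ v w)) (xy∙z≈xz∙y (childOf v w) (selfLoop v w) (parentOf v w))

  fire-balance : ∀ {c : Config k} {v} → suc k ≤ c v → ∀ w → fire k c v w + suc k * δ v w ≡ c w + inflow v w
  fire-balance {c} {v} k<cv w = balance (w ≟V v)
    where
    balance : (d : Dec (w ≡ v)) → (c w ∸ suc k * [ d ]) + inflow v w + suc k * [ d ] ≡ c w + inflow v w
    balance (yes w≡v) = trans (xy∙z≈xz∙y (c w ∸ suc k * 1) (inflow v w) (suc k * 1)) (cong (_+ inflow v w) (m∸n+n≡m k<cw))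
      where
      k<cw : suc k * 1 ≤ c w
      k<cw = subst₂ _≤_ (sym (*-identityʳ (suc k))) (cong c (sym w≡v)) k<cv
    balance (no _) = trans (cong (λ t → (c w ∸ t) + inflow v w + t) (*-zeroʳ (suc k))) (+-identityʳ _)

  -- c′ is what c becomes when every vertex u fires y u times, legal or not.
  record Reaches (c : Config k) (y : Vertex k → ℕ) (c′ : Config k) : Set where
    constructor reaches
    field conserved : ∀ w → c′ w + suc k * y w ≡ c w + received y w

  reaches-zero : ∀ {c} → Reaches c (λ _ → 0) c
  reaches-zero {c} = reaches λ w → cong (c w +_) (trans (*-zeroʳ (suc k)) (sym (received-zero w)))

  reaches-fire : ∀ {c v} → suc k ≤ c v → Reaches c (δ v) (fire k c v)
  reaches-fire {c} {v} k<cv = reaches λ w → trans (fire-balance k<cv w) (cong (c w +_) (sym (received-δ v w)))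

  reaches-trans : ∀ {c c′ c″ y z} → Reaches c y c′ → Reaches c′ z c″ → Reaches c (λ u → y u + z u) c″
  reaches-trans {c} {c′} {c″} {y} {z} (reaches c→c′) (reaches c′→c″) = reaches λ w → begin
    c″ w + suc k * (y w + z w)            ≡⟨ cong (c″ w +_) (*-distribˡ-+ (suc k) (y w) (z w)) ⟩
    c″ w + (suc k * y w + suc k * z w)    ≡⟨ x∙yz≈xz∙y (c″ w) _ _ ⟩
    c″ w + suc k * z w + suc k * y w      ≡⟨ cong (_+ suc k * y w) (c′→c″ w) ⟩
    c′ w + received z w + suc k * y w     ≡⟨ xy∙z≈xz∙y (c′ w) _ _ ⟩
    c′ w + suc k * y w + received z w     ≡⟨ cong (_+ received z w) (c→c′ w) ⟩
    c w + received y w + received z w     ≡⟨ +-assoc (c w) _ _ ⟩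
    c w + (received y w + received z w)   ≡⟨ cong (c w +_) (received-+ y z w) ⟨
    c w + received (λ u → y u + z u) w    ∎
    where open ≡-Reasoning

  firings : ∀ {c c′ m} → Run k c c′ m → Vertex k → ℕ
  firings (done _)     u = 0
  firings (step v _ r) u = δ v u + firings r u

  run-reaches : ∀ {c c′ m} (r : Run k c c′ m) → Reaches c (firings r) c′
  run-reaches (done _)         = reaches-zero
  run-reaches (step v k<cv r) = reaches-trans (reaches-fire k<cv) (run-reaches r)

  run-stable : ∀ {c c′ m} → Run k c c′ m → Stable k c′
  run-stable (done stable) = stable
  run-stable (step _ _ r)  = run-stable r

  run-rootFirings : ∀ {c c′ m} (r : Run k c c′ m) → m ≡ firings r []
  run-rootFirings (done _)     = refl
  run-rootFirings (step v _ r) = cong₂ _+_ (δ-root v) (run-rootFirings r)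

  Stabilizes : Config k → (Vertex k → ℕ) → Set
  Stabilizes c x = ∀ w → c w + received x w < suc k * suc (x w)

  reaches-stable⇒stabilizes : ∀ {c y c′} → Reaches c y c′ → Stable k c′ → Stabilizes c y
  reaches-stable⇒stabilizes {c} {y} {c′} (reaches c→c′) stable w = begin-strict
    c w + received y w     ≡⟨ c→c′ w ⟨
    c′ w + suc k * y w     <⟨ +-monoˡ-< (suc k * y w) (stable w) ⟩
    suc k + suc k * y w    ≡⟨ *-suc (suc k) (y w) ⟨
    suc k * suc (y w)      ∎
    where open ≤-Reasoning

  firable⇒below : ∀ {c₀ x y c v} → Stabilizes c₀ x → Reaches c₀ y c → (∀ u → y u ≤ x u) →
                  suc k ≤ c v → y v < x v
  firable⇒below {c₀} {x} {y} {c} {v} stab (reaches c₀→c) y≤x k<cv = ≤∧≢⇒< (y≤x v) y≢x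
    where
    open ≤-Reasoning
    y≢x : y v ≢ x v
    y≢x yv≡xv = <⇒≱ (+-cancelʳ-< (suc k * x v) (c v) (suc k) (begin-strict
      c v + suc k * x v       ≡⟨ cong (λ t → c v + suc k * t) yv≡xv ⟨
      c v + suc k * y v       ≡⟨ c₀→c v ⟩
      c₀ v + received y v     ≤⟨ +-monoʳ-≤ (c₀ v) (received-mono y≤x v) ⟩
      c₀ v + received x v     <⟨ stab v ⟩
      suc k * suc (x v)       ≡⟨ *-suc (suc k) (x v) ⟩
      suc k + suc k * x v     ∎)) k<cv

  leastAction : ∀ {c₀ x y c c′ m} → Stabilizes c₀ x → Reaches c₀ y c → (∀ u → y u ≤ x u) →
                (r : Run k c c′ m) → ∀ w → y w + firings r w ≤ x w
  leastAction         stab c₀→c y≤x (done _)          w = ≤-trans (≤-reflexive (+-identityʳ _)) (y≤x w)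
  leastAction {x = x} {y} stab c₀→c y≤x (step v k<cv r) w =
    ≤-trans (≤-reflexive (sym (+-assoc (y w) _ _)))
            (leastAction stab (reaches-trans c₀→c (reaches-fire k<cv)) y+δ≤x r w)
    where
    y+δ≤x : ∀ u → y u + δ v u ≤ x u
    y+δ≤x u with u ≟V v
    ... | yes refl = ≤-trans (≤-reflexive (+-comm (y u) 1)) (firable⇒below stab c₀→c y≤x k<cv)
    ... | no  _    = ≤-trans (≤-reflexive (+-identityʳ (y u))) (y≤x u)

  firings-≤ : ∀ {c x c′ m} → Stabilizes c x → (r : Run k c c′ m) → ∀ w → firings r w ≤ x w
  firings-≤ stab = leastAction stab reaches-zero (λ _ → z≤n)

  layerMin : (Vertex k → ℕ) → ℕ → ℕ
  layerMin f zero    = f []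
  layerMin f (suc d) = minimum (λ i → layerMin (λ u → f (i ∷ u)) d)

  layerMin-≤ : ∀ f u → layerMin f (length u) ≤ f u
  layerMin-≤ f []      = ≤-refl
  layerMin-≤ f (i ∷ u) = ≤-trans (minimum-≤ _ i) (layerMin-≤ (λ u → f (i ∷ u)) u)

  layerMin-attained : ∀ f u → ∃ λ u* → length u* ≡ length u × f u* ≡ layerMin f (length u)
  layerMin-attained f []      = [] , refl , refl
  layerMin-attained f (a ∷ p)
    with minimum-attained (λ i → layerMin (λ u → f (i ∷ u)) (length p)) a
  ... | i , i-min with layerMin-attained (λ u → f (i ∷ u)) p
  ...   | u* , same-depth , u*-min = i ∷ u* , cong suc same-depth , trans u*-min i-min

  received-layered : ∀ {y} (F : ℕ → ℕ) → (∀ w → y w ≡ F (length w)) →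
                     ∀ w → received y w ≡ F (length w ∸ 1) + k * F (suc (length w))
  received-layered {y} F layered w =
    cong₂ _+_ (up-layered w) (trans (sum-cong-≗ (λ i → layered (i ∷ w))) (sum-const k _))
    where
    up-layered : ∀ w → up y w ≡ F (length w ∸ 1)
    up-layered []      = layered []
    up-layered (_ ∷ p) = layered p

  initial-depth : ∀ N (u v : Vertex k) → length u ≡ length v → initial k N u ≡ initial k N v
  initial-depth N []      []      _ = refl
  initial-depth N (_ ∷ _) (_ ∷ _) _ = refl

  -- x is stabilizing because every vertex can be compared with a minimiser on its layer.
  firings-layered : ∀ {N c′ m} (r : Run k (initial k N) c′ m) →
                    ∀ w → firings r w ≡ layerMin (firings r) (length w)
  firings-layered {N} r w = ≤-antisym (firings-≤ stab r w) (layerMin-≤ y w)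
    where
    open ≤-Reasoning
    y = firings r
    x : Vertex k → ℕ
    x u = layerMin y (length u)
    received-x : ∀ u v → length u ≡ length v → received x u ≡ received x v
    received-x u v same-depth =
      begin-equality
        received x u                                        ≡⟨ received-layered (layerMin y) (λ _ → refl) u ⟩
        layerMin y (length u ∸ 1) + k * layerMin y (suc (length u)) ≡⟨ cong (λ d → layerMin y (d ∸ 1) + k * layerMin y (suc d)) same-depth ⟩
        layerMin y (length v ∸ 1) + k * layerMin y (suc (length v)) ≡⟨ received-layered (layerMin y) (λ _ → refl) v ⟨
        received x v ∎
    stab : Stabilizes (initial k N) x
    stab u with layerMin-attained y u
    ... | u* , same-depth , u*-min = begin-strict
      initial k N u + received x u    ≡⟨ cong₂ _+_ (initial-depth N u u* (sym same-depth)) (received-x u u* (sym same-depth)) ⟩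
      initial k N u* + received x u*  ≤⟨ +-monoʳ-≤ (initial k N u*) (received-mono (layerMin-≤ y) u*) ⟩
      initial k N u* + received y u*  <⟨ reaches-stable⇒stabilizes (run-reaches r) (run-stable r) u* ⟩
      suc k * suc (y u*)              ≡⟨ cong (λ t → suc k * suc t) u*-min ⟩
      suc k * suc (x u)               ∎

  firings-vanish : ∀ {N c′ f} m → N ≤ k * geom k (suc m) → (r : Run k (initial k N) c′ f) →
                   ∀ w → m ≤ length w → firings r w ≡ 0
  firings-vanish {N} m N≤ r w m≤depth =
    n≤0⇒n≡0 (≤-trans (firings-≤ stab r w) (≤-reflexive (cong (profile k) (m≤n⇒m∸n≡0 m≤depth))))
    where
    x : Vertex k → ℕ
    x u = profile k (m ∸ length u)
    layered-bound : ∀ u → initial k N u + (profile k (m ∸ (length u ∸ 1)) + k * profile k (m ∸ suc (length u)))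
                          < suc k * suc (x u)
    layered-bound []      = profile-root k N m N≤
    layered-bound (_ ∷ p) = profile-interior k m (length p)
    stab : Stabilizes (initial k N) x
    stab u = subst (λ t → initial k N u + t < suc k * suc (x u))
                   (sym (received-layered (λ d → profile k (m ∸ d)) (λ _ → refl) u)) (layered-bound u)

  run-layer-balance : ∀ {N c′ f} (r : Run k (initial k N) c′ f) (a : Fin k) {p d} → length p ≡ d →
    let F = layerMin (firings r) in c′ (a ∷ p) + suc k * F (suc d) ≡ F d + k * F (suc (suc d))
  run-layer-balance {c′ = c′} r a {p} refl = begin
    c′ (a ∷ p) + suc k * F (suc (length p))       ≡⟨ cong (λ t → c′ (a ∷ p) + suc k * t) (firings-layered r (a ∷ p)) ⟨
    c′ (a ∷ p) + suc k * firings r (a ∷ p)        ≡⟨ Reaches.conserved (run-reaches r) (a ∷ p) ⟩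
    received (firings r) (a ∷ p)                  ≡⟨ received-layered F (firings-layered r) (a ∷ p) ⟩
    F (length p) + k * F (suc (suc (length p)))   ∎
    where
    open ≡-Reasoning
    F = layerMin (firings r)

mainTheorem6 : (k N : ℕ) → (hk : 2 ≤ k) → 1 ≤ N →
    (n : ℕ) → k ^ n ≤ N * (k ∸ 1) + 1 → N * (k ∸ 1) + 1 < k ^ suc n →
    (c : Config k) (f0 : ℕ) → Run k (initial k N) c f0 →
    (k ∸ 1) * f0 ≡ sumFrom1 (n ∸ 1) (λ j → (k ^ j ∸ 1) * c (leftmost k hk j))
mainTheorem6 k N hk _ n _ N[k∸1]+1<k^[1+n] c f0 r = begin
  (k ∸ 1) * f0                                   ≡⟨ cong ((k ∸ 1) *_) (run-rootFirings r) ⟩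
  (k ∸ 1) * F 0                                  ≡⟨ cong ((k ∸ 1) *_) (weighted-chips≡root k F C balance m (vanish ≤-refl) (vanish (n≤1+n m))) ⟨
  (k ∸ 1) * sumFrom1 m (λ j → geom k j * C j)    ≡⟨ sumFrom1-*ˡ (k ∸ 1) m _ ⟨
  sumFrom1 m (λ j → (k ∸ 1) * (geom k j * C j))  ≡⟨ sumFrom1-cong m (λ j → trans (sym (*-assoc (k ∸ 1) _ _)) (cong (_* C j) (sym (k^j∸1≡[k∸1]*geom k j)))) ⟩
  sumFrom1 m (λ j → (k ^ j ∸ 1) * C j)           ∎
  where
  open ≡-Reasoning
  open ChipFiring k
  m = n ∸ 1
  F = layerMin (firings r)
  C : ℕ → ℕ
  C j = c (leftmost k hk j)
  depth : ∀ j → length (leftmost k hk j) ≡ j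
  depth j = length-replicate j
  balance : LayerBalance k F C
  balance e = run-layer-balance r _ (depth e)
  vanish : ∀ {d} → m ≤ d → F d ≡ 0
  vanish {d} m≤d = begin
    F d                              ≡⟨ cong F (depth d) ⟨
    F (length (leftmost k hk d))     ≡⟨ firings-layered r (leftmost k hk d) ⟨
    firings r (leftmost k hk d)      ≡⟨ firings-vanish m (geom-upper-bound k N n N[k∸1]+1<k^[1+n]) r (leftmost k hk d)
                                                         (subst (m ≤_) (sym (depth d)) m≤d) ⟩
    0                                ∎
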